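{- Let $d,r\geq 1$ and let $A=\{\vec a_1,\dots,\vec a_{d+1}\}$ be the vertex set of an alcove of $r\Delta_{1,d}$, with the vertices ordered so that the collection of $r$-multisets $\mathcal{I}_A=\{I_{\vec a_1},\dots,I_{\vec a_{d+1}}\}$ is sorted. Then the decorated matrix $\widetilde M_{\mathcal{I}_A}$ has the following properties: (1) for each $1\leq i\leq d$ there is exactly one mark between rows $i$ and $i+1$; (2) there are no marks on the bottom edges of the cells of the last row.
   Context: $r\Delta_{1,d}=\{x\in\mathbb{R}^{d+1}: x_k\geq 0,\ \sum_k x_k=r\}$. Alcoves: the hyperplanes $x_{a+1}+\dots+x_b=m$ ($0\leq a<b\leq d+1$, $m\in\mathbb{Z}$) subdivide this polytope into unimodular lattice simplices; alcoves are the maximal simplices, identified with their vertex sets. For $\vec a\in\mathbb{N}^{n}$ with coordinate sum $k$, $I_{\vec a}$ is the $k$-multiset of $[n]$ containing $a_t$ copies of $t$. A collection $I_1,\dots,I_m$ of $k$-multisets of $[n]$, written $I_a=\{I_{a1}\leq\dots\leq I_{ak}\}$, is sorted (in this order) if $I_{11}\leq I_{21}\leq\dots\leq I_{m1}\leq I_{12}\leq I_{22}\leq\dots\leq I_{m2}\leq\dots\leq I_{mk}$; it is known (Lam–Postnikov) that the vertex multisets of an alcove can be so ordered. The matrix $M$ has rows $I_1,\dots,I_m$ (an $m\times k$ grid). The decorated matrix $\widetilde M$ is $M$ with marks: the edge between cells $(a,b)$ and $(a+1,b)$ is marked iff $I_{ab}<I_{(a+1)b}$; the bottom edge of cell $(m,b)$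 ($b<k$) is marked iff $I_{mb}<I_{1(b+1)}$. -}

module Defs where

open import Data.Nat using (ℕ; zero; suc; _+_; _≤_; _<_; _≤?_; _<?_)
open import Data.Fin using (Fin; toℕ)
open import Data.List using (List; []; _∷_; map; concatMap; replicate)
open import Data.Nat.ListAction using (sum)
open import Data.List using () renaming (allFin to allFinL)
open import Data.Bool using (if_then_else_; _∧_)
open import Relation.Nullary.Decidable using (⌊_⌋)
open import Relation.Binary.PropositionalEquality using (_≡_)
open import Relation.Nullary using (¬_)
open import Data.Product using (Σ; _×_)

-- A point of ℕ^n, coordinates indexed by Fin n (coordinate t is x_{t+1}).
Point : ℕ → Set
Point n = Fin n → ℕ

coordSum : {n : ℕ} → Point n → ℕ
coordSum {n} x = sum (map x (allFinL n))

-- segSum x a b = x_{a+1} + ... + x_b   (paper's 1-based coordinates)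
segSum : {n : ℕ} → Point n → ℕ → ℕ → ℕ
segSum {n} x a b =
  sum (map (λ t → if ⌊ a ≤? toℕ t ⌋ ∧ ⌊ toℕ t <? b ⌋ then x t else 0) (allFinL n))

-- The multiset I_x of [n] (as a weakly increasing list): x_t copies of t,
-- with t ranging over 1..n.
multiset : {n : ℕ} → Point n → List ℕ
multiset {n} x = concatMap (λ t → replicate (x t) (suc (toℕ t))) (allFinL n)

-- 0-indexed lookup with default 0 (default never used for indices < length)
nth : List ℕ → ℕ → ℕ
nth [] _ = 0
nth (y ∷ ys) zero = y
nth (y ∷ ys) (suc b) = nth ys b

-- Entry I_{ab} of the matrix M whose a-th row is the multiset I_{v a}
-- (rows and columns 0-indexed here).
entry : {m n : ℕ} → (Fin m → Point n) → Fin m → ℕ → ℕ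
entry v a b = nth (multiset (v a)) b

-- A family v : Fin (d+1) → ℕ^{d+1} is the (ordered) vertex set of an alcove of
-- rΔ_{1,d}: d+1 pairwise distinct lattice points of rΔ_{1,d} which all lie in a
-- common closed cell of the arrangement x_{a+1}+…+x_b = m, i.e. for every
-- 0 ≤ a < b ≤ d+1 the values x_{a+1}+…+x_b at the vertices differ by at most 1.
IsAlcove : (d r : ℕ) → (Fin (suc d) → Point (suc d)) → Set
IsAlcove d r v =
  ((i : Fin (suc d)) → coordSum (v i) ≡ r) ×
  ((i j : Fin (suc d)) → ¬ (i ≡ j) → ¬ ((t : Fin (suc d)) → v i t ≡ v j t)) ×
  ((a b : ℕ) → a < b → b ≤ suc d → (i j : Fin (suc d)) →
      segSum (v i) a b ≤ suc (segSum (v j) a b))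

-- Sortedness of the collection of k-multisets given by rows of the matrix:
-- I_{11} ≤ I_{21} ≤ … ≤ I_{m1} ≤ I_{12} ≤ … ≤ I_{mk}.
Sorted : {m n : ℕ} → (k : ℕ) → (Fin (suc m) → Point n) → Set
Sorted {m} k v =
  ((a : Fin m) (b : ℕ) → b < k →
      entry v (Data.Fin.inject₁ a) b ≤ entry v (Data.Fin.suc a) b) ×
  ((b : ℕ) → suc b < k → entry v (Data.Fin.fromℕ m) b ≤ entry v Data.Fin.zero (suc b))

-- Mark between cells (a,b) and (a+1,b) (a : Fin m indexes rows a, a+1 of m+1 rows).
MarkBetween : {m n : ℕ} → (Fin (suc m) → Point n) → Fin m → ℕ → Set
MarkBetween v a b = entry v (Data.Fin.inject₁ a) b < entry v (Data.Fin.suc a) b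

-- Mark on bottom edge of cell (last row, b), for b+1 < k.
MarkBottom : {m n : ℕ} → (Fin (suc m) → Point n) → ℕ → Set
MarkBottom {m} v b = entry v (Data.Fin.fromℕ m) b < entry v Data.Fin.zero (suc b)

-- Read the matrix column by column: I₁₁, I₂₁, …, I_{d+1,1}, I₁₂, ….  Sortedness says
-- that this word is weakly increasing, and its letters lie in [1, d+1], so its strict
-- ascents start at pairwise distinct letters of [1, d]: there are at most d of them.
-- Every mark of the decorated matrix is an ascent of the word.  Distinct vertices give
-- distinct rows, so each of the d pairs of consecutive rows carries a mark; these d
-- marks exhaust all ascents, hence there are no further marks.  Only distinctness of
-- the vertices, the coordinate sum r and sortedness are used.
module Submission where

open import Defs
open import Data.Nat using (ℕ; suc; _≤_; _<_)
open import Data.Fin as Fin using (Fin)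
open import Data.Product using (Σ; _×_)
open import Relation.Binary.PropositionalEquality using (_≡_)
open import Relation.Nullary using (¬_)

open import Data.Nat
  using (zero; _+_; _*_; _∸_; _≤′_; ≤′-refl; ≤′-step; z≤n; s≤s; z<s; s<s; _≟_)
open import Data.Nat.Properties hiding (<⇒≢)
open import Data.Nat.DivMod
  using (_%_; _/_; m%n<n; m≡m%n+[m/n]*n; [m+kn]%n≡m%n; m<n⇒m%n≡m; m<n*o⇒m/o<n)
open import Data.Nat.ListAction using (sum)
open import Data.Fin using (toℕ; fromℕ; fromℕ<; inject₁)
open import Data.Fin.Properties
  using (toℕ<n; toℕ-injective; toℕ-fromℕ; toℕ-fromℕ<; fromℕ<-injective; toℕ-inject₁;
         inject₁-injective; fromℕ≢inject₁; ≤̄⇒inject₁<; <⇒≢; any?; injective⇒≤)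
open import Data.List
  using (List; []; _∷_; _++_; length; replicate; concat; concatMap; map; tabulate; allFin)
open import Data.List.Properties using (length-++; length-replicate; map-tabulate; ∷-injectiveʳ)
open import Data.List.Relation.Unary.All using (All; []; _∷_; universal)
open import Data.List.Relation.Unary.All.Properties using (concat⁺; map⁺; tabulate⁺; replicate⁺)
open import Data.Vec.Functional using () renaming (_∷_ to _◂_)
open import Data.Product using (∃; _,_; proj₁; proj₂; map₁)
open import Data.Sum using (_⊎_; inj₁; inj₂)
open import Data.Empty using (⊥-elim)
open import Relation.Binary.Definitions using (tri<; tri≈; tri>)
open import Function using (_∘_; id; Injective)
open import Relation.Nullary using (yes; no)
open import Relation.Binary.PropositionalEquality
  using (_≢_; refl; sym; trans; cong; cong₂; subst; subst₂; module ≡-Reasoning)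

nth-All : ∀ {P : ℕ → Set} {xs b} → All P xs → b < length xs → P (nth xs b)
nth-All {b = zero}  (px ∷ _)   _          = px
nth-All {b = suc b} (_  ∷ pxs) (s<s b<n) = nth-All pxs b<n

nth-differ : ∀ xs ys → length xs ≡ length ys → xs ≢ ys →
             ∃ λ b → b < length xs × nth xs b ≢ nth ys b
nth-differ []       []       _  xs≢ys = ⊥-elim (xs≢ys refl)
nth-differ (x ∷ xs) (y ∷ ys) eq xs≢ys with x ≟ y
... | no x≢y = 0 , z<s , x≢y
... | yes refl
  with b , b<n , differ ← nth-differ xs ys (suc-injective eq) (xs≢ys ∘ cong (x ∷_))
  = suc b , s<s b<n , differ

length-concatMap-replicate : ∀ {A : Set} (c ℓ : A → ℕ) (ts : List A) →
  length (concatMap (λ t → replicate (c t) (ℓ t)) ts) ≡ sum (map c ts)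
length-concatMap-replicate c ℓ []       = refl
length-concatMap-replicate c ℓ (t ∷ ts) =
  trans (length-++ (replicate (c t) (ℓ t)))
        (cong₂ _+_ (length-replicate (c t)) (length-concatMap-replicate c ℓ ts))

head-absent : ∀ {z xs ys} → All (z <_) xs → xs ≢ z ∷ ys
head-absent (z<z ∷ _) refl = <-irrefl refl z<z

replicate-++-cancel : ∀ {z} a b {xs ys} → All (z <_) xs → All (z <_) ys →
                      replicate a z ++ xs ≡ replicate b z ++ ys → a ≡ b × xs ≡ ys
replicate-++-cancel zero    zero    _   _   eq = refl , eq
replicate-++-cancel zero    (suc b) pxs _   eq = ⊥-elim (head-absent pxs eq)
replicate-++-cancel (suc a) zero    _   pys eq = ⊥-elim (head-absent pys (sym eq))
replicate-++-cancel (suc a) (suc b) pxs pys eq =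
  map₁ (cong suc) (replicate-++-cancel a b pxs pys (∷-injectiveʳ eq))

blocks : ∀ {n} → (Fin n → ℕ) → (Fin n → ℕ) → List ℕ
blocks c ℓ = concat (tabulate λ t → replicate (c t) (ℓ t))

blocks-above : ∀ {n z} (c ℓ : Fin n → ℕ) → (∀ t → z < ℓ t) → All (z <_) (blocks c ℓ)
blocks-above c ℓ above = concat⁺ (tabulate⁺ λ t → replicate⁺ (c t) (above t))

blocks-injective : ∀ {n} (ℓ : Fin n → ℕ) → (∀ {s t} → toℕ s < toℕ t → ℓ s < ℓ t) →
                   (c c′ : Fin n → ℕ) → blocks c ℓ ≡ blocks c′ ℓ → ∀ t → c t ≡ c′ t
blocks-injective {zero}  _ _ _ _ _ ()
blocks-injective {suc n} ℓ ℓ-mono c c′ eq = pointwise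
  where
  heads-and-tails : c Fin.zero ≡ c′ Fin.zero ×
                    blocks (c ∘ Fin.suc) (ℓ ∘ Fin.suc) ≡ blocks (c′ ∘ Fin.suc) (ℓ ∘ Fin.suc)
  heads-and-tails = replicate-++-cancel (c Fin.zero) (c′ Fin.zero)
    (blocks-above (c ∘ Fin.suc) (ℓ ∘ Fin.suc) λ _ → ℓ-mono z<s)
    (blocks-above (c′ ∘ Fin.suc) (ℓ ∘ Fin.suc) λ _ → ℓ-mono z<s) eq
  pointwise : ∀ t → c t ≡ c′ t
  pointwise Fin.zero    = proj₁ heads-and-tails
  pointwise (Fin.suc t) = blocks-injective (ℓ ∘ Fin.suc) (ℓ-mono ∘ s<s)
    (c ∘ Fin.suc) (c′ ∘ Fin.suc) (proj₂ heads-and-tails) t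

multiset≡blocks : ∀ {n} (x : Point n) → multiset x ≡ blocks x (suc ∘ toℕ)
multiset≡blocks {n} x =
  cong concat (map-tabulate {n = n} id λ t → replicate (x t) (suc (toℕ t)))

multiset-injective : ∀ {n} {x y : Point n} → multiset x ≡ multiset y → ∀ t → x t ≡ y t
multiset-injective {x = x} {y} eq =
  blocks-injective (suc ∘ toℕ) s<s x y
    (trans (sym (multiset≡blocks x)) (trans eq (multiset≡blocks y)))

length-multiset : ∀ {n} (x : Point n) → length (multiset x) ≡ coordSum x
length-multiset {n} x = length-concatMap-replicate x (suc ∘ toℕ) (allFin n)

multiset-bounded : ∀ {n} (x : Point n) → All (λ y → 1 ≤ y × y ≤ n) (multiset x)
multiset-bounded {n} x =
  concat⁺ (map⁺ (universal (λ t → replicate⁺ (x t) (s≤s z≤n , toℕ<n t)) (allFin n)))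

fromℕ-or-inject₁ : ∀ {m} (a : Fin (suc m)) → a ≡ fromℕ m ⊎ ∃ λ a′ → a ≡ inject₁ a′
fromℕ-or-inject₁ {zero}  Fin.zero    = inj₁ refl
fromℕ-or-inject₁ {suc m} Fin.zero    = inj₂ (Fin.zero , refl)
fromℕ-or-inject₁ {suc m} (Fin.suc a) with fromℕ-or-inject₁ a
... | inj₁ a≡last       = inj₁ (cong Fin.suc a≡last)
... | inj₂ (a′ , a≡a′) = inj₂ (Fin.suc a′ , cong Fin.suc a≡a′)

module ColumnReading {m : ℕ} (M : Fin (suc m) → ℕ → ℕ) where

  pos : Fin (suc m) → ℕ → ℕ
  pos a b = toℕ a + b * suc m

  row : ℕ → Fin (suc m)
  row p = fromℕ< (m%n<n p (suc m))

  col : ℕ → ℕ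
  col p = p / suc m

  read : ℕ → ℕ
  read p = M (row p) (col p)

  pos-row-col : ∀ p → pos (row p) (col p) ≡ p
  pos-row-col p =
    trans (cong (_+ col p * suc m) (toℕ-fromℕ< _)) (sym (m≡m%n+[m/n]*n p (suc m)))

  row-pos : ∀ a b → row (pos a b) ≡ a
  row-pos a b = toℕ-injective (begin
    toℕ (row (pos a b))  ≡⟨ toℕ-fromℕ< _ ⟩
    pos a b % suc m      ≡⟨ [m+kn]%n≡m%n (toℕ a) b (suc m) ⟩
    toℕ a % suc m        ≡⟨ m<n⇒m%n≡m (toℕ<n a) ⟩
    toℕ a                ∎)
    where open ≡-Reasoning

  col-pos : ∀ a b → col (pos a b) ≡ b
  col-pos a b = *-cancelʳ-≡ _ _ (suc m) (+-cancelˡ-≡ (toℕ a) _ _ (begin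
    toℕ a + col p * suc m    ≡⟨ cong (λ i → toℕ i + col p * suc m) (row-pos a b) ⟨
    pos (row p) (col p)      ≡⟨ pos-row-col p ⟩
    p                        ∎))
    where
    open ≡-Reasoning
    p : ℕ
    p = pos a b

  pos-injective : ∀ a b a′ b′ → pos a b ≡ pos a′ b′ → a ≡ a′ × b ≡ b′
  pos-injective a b a′ b′ eq =
    trans (sym (row-pos a b)) (trans (cong row eq) (row-pos a′ b′)) ,
    trans (sym (col-pos a b)) (trans (cong col eq) (col-pos a′ b′))

  read-pos : ∀ a b → read (pos a b) ≡ M a b
  read-pos a b = cong₂ M (row-pos a b) (col-pos a b)

  suc-pos-inject₁ : ∀ a b → suc (pos (inject₁ a) b) ≡ pos (Fin.suc a) b
  suc-pos-inject₁ a b = cong (λ i → suc (i + b * suc m)) (toℕ-inject₁ a)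

  suc-pos-fromℕ : ∀ b → suc (pos (fromℕ m) b) ≡ pos Fin.zero (suc b)
  suc-pos-fromℕ b = cong (λ i → suc (i + b * suc m)) (toℕ-fromℕ m)

  read-adjacent : ∀ (R : ℕ → ℕ → Set) {a b a′ b′} → suc (pos a b) ≡ pos a′ b′ →
                  R (M a b) (M a′ b′) → R (read (pos a b)) (read (suc (pos a b)))
  read-adjacent R {a} {b} {a′} {b′} next rel =
    subst₂ R (sym (read-pos a b)) (sym (trans (cong read next) (read-pos a′ b′))) rel

  pos<⇒col< : ∀ {k} a b → pos a b < k * suc m → b < k
  pos<⇒col< a b p<km = subst (_< _) (col-pos a b) (m<n*o⇒m/o<n p<km)

  col<⇒pos< : ∀ {k} a b → b < k → pos a b < k * suc m
  col<⇒pos< a b b<k = ≤-trans (+-monoˡ-< (b * suc m) (toℕ<n a)) (*-monoˡ-≤ (suc m) b<k)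

  module _ {k : ℕ}
    (sorted-down : ∀ a b → b < k → M (inject₁ a) b ≤ M (Fin.suc a) b)
    (sorted-wrap : ∀ b → suc b < k → M (fromℕ m) b ≤ M Fin.zero (suc b)) where

    read-step-pos : ∀ a b → suc (pos a b) < k * suc m → read (pos a b) ≤ read (suc (pos a b))
    read-step-pos a b next<km with fromℕ-or-inject₁ a
    ... | inj₁ refl = read-adjacent _≤_ (suc-pos-fromℕ b) (sorted-wrap b
      (pos<⇒col< Fin.zero (suc b) (subst (_< k * suc m) (suc-pos-fromℕ b) next<km)))
    ... | inj₂ (a′ , refl) = read-adjacent _≤_ (suc-pos-inject₁ a′ b) (sorted-down a′ b
      (pos<⇒col< (Fin.suc a′) b (subst (_< k * suc m) (suc-pos-inject₁ a′ b) next<km)))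

    read-step : ∀ p → suc p < k * suc m → read p ≤ read (suc p)
    read-step p = subst (λ q → suc q < k * suc m → read q ≤ read (suc q))
                        (pos-row-col p) (read-step-pos (row p) (col p))

module Ascents (f : ℕ → ℕ) (N : ℕ) (step : ∀ p → suc p < N → f p ≤ f (suc p)) where

  Ascent : ℕ → Set
  Ascent p = suc p < N × f p < f (suc p)

  monotone : ∀ {p q} → p ≤′ q → q < N → f p ≤ f q
  monotone ≤′-refl            _     = ≤-refl
  monotone (≤′-step {q} p≤′q) 1+q<N = ≤-trans (monotone p≤′q (<⇒≤ 1+q<N)) (step q 1+q<N)

  ascent-increasing : ∀ {p q} → Ascent p → p < q → q < N → f p < f q
  ascent-increasing (_ , up) p<q q<N = <-≤-trans up (monotone (≤⇒≤′ p<q) q<N)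

  ascent-injective : ∀ {p q} → Ascent p → Ascent q → f p ≡ f q → p ≡ q
  ascent-injective {p} {q} ascent-p ascent-q fp≡fq with <-cmp p q
  ... | tri< p<q _ _ =
    ⊥-elim (<-irrefl fp≡fq (ascent-increasing ascent-p p<q (<⇒≤ (proj₁ ascent-q))))
  ... | tri≈ _ p≡q _ = p≡q
  ... | tri> _ _ q<p =
    ⊥-elim (<-irrefl (sym fp≡fq) (ascent-increasing ascent-q q<p (<⇒≤ (proj₁ ascent-p))))

  module _ (lo k : ℕ) (bounded : ∀ p → p < N → lo ≤ f p × f p ≤ lo + k) where

    ascents-bounded : ∀ {j} (Q : Fin j → ℕ) → Injective _≡_ _≡_ Q →
                      (∀ i → Ascent (Q i)) → j ≤ k
    ascents-bounded Q Q-injective ascent = injective⇒≤ slot-injective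
      where
      lo≤ : ∀ i → lo ≤ f (Q i)
      lo≤ i = proj₁ (bounded (Q i) (<⇒≤ (proj₁ (ascent i))))

      offset<k : ∀ i → f (Q i) ∸ lo < k
      offset<k i = begin-strict
        f (Q i) ∸ lo        <⟨ ∸-monoˡ-< (proj₂ (ascent i)) (lo≤ i) ⟩
        f (suc (Q i)) ∸ lo  ≤⟨ ∸-monoˡ-≤ lo (proj₂ (bounded (suc (Q i)) (proj₁ (ascent i)))) ⟩
        lo + k ∸ lo         ≡⟨ m+n∸m≡n lo k ⟩
        k                   ∎
        where open ≤-Reasoning

      slot-injective : Injective _≡_ _≡_ (λ i → fromℕ< (offset<k i))
      slot-injective {i} {i′} eq = Q-injective (ascent-injective (ascent i) (ascent i′)
        (∸-cancelʳ-≡ (lo≤ i) (lo≤ i′) (fromℕ<-injective _ _ (offset<k i) (offset<k i′) eq)))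

    ascent-among : (Q : Fin k → ℕ) → Injective _≡_ _≡_ Q → (∀ i → Ascent (Q i)) →
                   ∀ {q} → Ascent q → ∃ λ i → q ≡ Q i
    ascent-among Q Q-injective ascent {q} ascent-q with any? (λ i → q ≟ Q i)
    ... | yes found = found
    ... | no missing =
      ⊥-elim (1+n≰n (ascents-bounded (q ◂ Q) extended-injective extended-ascent))
      where
      extended-injective : Injective _≡_ _≡_ (q ◂ Q)
      extended-injective {Fin.zero}  {Fin.zero}  _  = refl
      extended-injective {Fin.zero}  {Fin.suc j} eq = ⊥-elim (missing (j , eq))
      extended-injective {Fin.suc i} {Fin.zero}  eq = ⊥-elim (missing (i , sym eq))
      extended-injective {Fin.suc i} {Fin.suc j} eq = cong Fin.suc (Q-injective eq)

      extended-ascent : ∀ i → Ascent ((q ◂ Q) i)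
      extended-ascent Fin.zero    = ascent-q
      extended-ascent (Fin.suc i) = ascent i

module SortedAlcove {d r : ℕ} {v : Fin (suc d) → Point (suc d)}
                    (alcove : IsAlcove d r v) (sorted : Sorted r v) where

  open ColumnReading (entry v)
  open Ascents read (r * suc d) (read-step (proj₁ sorted) (proj₂ sorted))

  row-length : ∀ a → length (multiset (v a)) ≡ r
  row-length a = trans (length-multiset (v a)) (proj₁ alcove a)

  rows-differ : ∀ {a a′} → a ≢ a′ → multiset (v a) ≢ multiset (v a′)
  rows-differ a≢a′ eq = proj₁ (proj₂ alcove) _ _ a≢a′ (multiset-injective eq)

  read-bounded : ∀ p → p < r * suc d → 1 ≤ read p × read p ≤ 1 + d
  read-bounded p p<N = nth-All (multiset-bounded (v (row p)))
    (subst (col p <_) (sym (row-length (row p))) (m<n*o⇒m/o<n p<N))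

  mark-exists : ∀ i → ∃ λ b → b < r × MarkBetween v i b
  mark-exists i
    with b , b<len , differ ← nth-differ (multiset (v (inject₁ i))) (multiset (v (Fin.suc i)))
           (trans (row-length _) (sym (row-length _))) (rows-differ (<⇒≢ (≤̄⇒inject₁< ≤-refl)))
    = b , b<r , ≤∧≢⇒< (proj₁ sorted i b b<r) differ
    where
    b<r : b < r
    b<r = subst (b <_) (row-length _) b<len

  column : Fin d → ℕ
  column i = proj₁ (mark-exists i)

  column-mark : ∀ i → column i < r × MarkBetween v i (column i)
  column-mark i = proj₂ (mark-exists i)

  between-ascent : ∀ i b → b < r → MarkBetween v i b → Ascent (pos (inject₁ i) b)
  between-ascent i b b<r mark =
    subst (_< r * suc d) (sym (suc-pos-inject₁ i b)) (col<⇒pos< (Fin.suc i) b b<r) ,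
    read-adjacent _<_ (suc-pos-inject₁ i b) mark

  bottom-ascent : ∀ b → suc b < r → MarkBottom v b → Ascent (pos (fromℕ d) b)
  bottom-ascent b 1+b<r mark =
    subst (_< r * suc d) (sym (suc-pos-fromℕ b)) (col<⇒pos< Fin.zero (suc b) 1+b<r) ,
    read-adjacent _<_ (suc-pos-fromℕ b) mark

  chosen-injective : Injective _≡_ _≡_ (λ i → pos (inject₁ i) (column i))
  chosen-injective {i} {j} eq =
    inject₁-injective (proj₁ (pos-injective (inject₁ i) (column i) (inject₁ j) (column j) eq))

  every-ascent-chosen : ∀ {q} → Ascent q → ∃ λ i → q ≡ pos (inject₁ i) (column i)
  every-ascent-chosen = ascent-among 1 d read-bounded _ chosen-injective
    λ i → between-ascent i (column i) (proj₁ (column-mark i)) (proj₂ (column-mark i))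

  mark-unique : ∀ i b → b < r → MarkBetween v i b → b ≡ column i
  mark-unique i b b<r mark
    with j , eq ← every-ascent-chosen (between-ascent i b b<r mark)
    with i≡j , b≡column-j ← pos-injective (inject₁ i) b (inject₁ j) (column j) eq
    = trans b≡column-j (cong column (sym (inject₁-injective i≡j)))

  no-bottom-mark : ∀ b → suc b < r → ¬ MarkBottom v b
  no-bottom-mark b 1+b<r mark
    with j , eq ← every-ascent-chosen (bottom-ascent b 1+b<r mark)
    = fromℕ≢inject₁ (proj₁ (pos-injective (fromℕ d) b (inject₁ j) (column j) eq))

lemma3p5 : (d r : ℕ) → 1 ≤ d → 1 ≤ r →
    (v : Fin (suc d) → Point (suc d)) → IsAlcove d r v → Sorted r v →
    ((i : Fin d) → Σ ℕ (λ b → (b < r × MarkBetween v i b) ×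
        ((b' : ℕ) → b' < r → MarkBetween v i b' → b' ≡ b)))
    × ((b : ℕ) → suc b < r → ¬ MarkBottom v b)
lemma3p5 d r _ _ v alcove sorted =
  (λ i → column i , column-mark i , mark-unique i) , no-bottom-mark
  where open SortedAlcove alcove sorted
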